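{- Let $b$ be an integer base. The number of integers $y$ with $0 < y < b - 1$ for which there exists a positive integer $n$ satisfying \[ b = \frac{(n + 1)(2(y + 1) - n)}{2} \] is one less than the number of odd divisors of $b$.
   Context: Here $b \geq 3$ is an integer base. The equation $b = (n+1)(2(y+1)-n)/2$ arises from the comma sequence starting at the base-$b$ integer $(b-1, b-1, \dots, b-1, 0, y)_b$: while it stays in the danger interval $[b^k - b^2, b^k)$ its last two digits $(x(n), y(n))$ satisfy $x(0)=0$, $y(0)=y$, $y(n+1)=y(n)-1$, $x(n+1)=x(n)+y(n)+1$, so that $x(n)+y(n) = (n+1)y - n(n-1)/2$, and the condition $x(n)+y(n)=b-1$ is equivalent to the displayed equation. -}

module Defs where

open import Data.Nat using (ℕ; suc; _+_; _*_; _<_; _∸_)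
open import Data.Nat.Divisibility using (_∣_)
open import Relation.Nullary using (¬_)
open import Data.Integer as ℤ using (ℤ; +_)
open import Data.List using (List; length)
open import Data.List.Relation.Unary.Unique.Propositional using (Unique)
open import Data.List.Membership.Propositional using (_∈_)
open import Data.Product using (Σ; ∃; _×_)
open import Function.Bundles using (_⇔_)
open import Relation.Binary.PropositionalEquality using (_≡_)

-- "The set {x ∈ ℕ | P x} is finite with exactly k elements":
-- witnessed by a duplicate-free list enumerating exactly the x with P x.
HasCard : (ℕ → Set) → ℕ → Set
HasCard P k = Σ (List ℕ) λ L → Unique L × (∀ x → (x ∈ L) ⇔ P x) × (length L ≡ k)

-- b = (n+1)(2(y+1) - n)/2, stated over ℤ after multiplying by 2
-- (so the subtraction is genuine integer subtraction).
CommaEq : ℕ → ℕ → ℕ → Set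
CommaEq b y n = + (2 * b) ≡ (+ (n + 1)) ℤ.* ((+ (2 * (y + 1))) ℤ.- (+ n))

GoodY : ℕ → ℕ → Set
GoodY b y = (0 < y) × (y < b ∸ 1) × ∃ λ n → (0 < n) × CommaEq b y n

OddDivisor : ℕ → ℕ → Set
OddDivisor b d = (d ∣ b) × ¬ (2 ∣ d)

module Submission where

-- Put m = 2(y+1) - n, which cannot be negative, so that the equation reads
-- 2b = (n+1) m.  Since (n+1) + m = 2y + 3 is odd, exactly one of n + 1 and m is
-- odd; calling it 2e + 1 and the other 2q gives b = q(2e+1) and y + 1 = e + q,
-- and y < b - 1 forces e ≥ 1.  Conversely an odd divisor 2e + 1 > 1 of b = q(2e+1)
-- yields the solution y = e + q - 1, n = 2e, and distinct such divisors yield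
-- distinct y: e + q and q(2e+1) determine e, as the two roots e of
-- (s - e)(2e+1) = b would sum to s - 1/2.  So the admissible y correspond
-- bijectively to the odd divisors of b other than 1.

open import Defs
open import Data.Nat using (ℕ; zero; suc; _+_; _*_; _∸_; _≤_; _<_; _≟_; _≤?_; s≤s; z<s; ⌊_/2⌋)
open import Data.Nat.Properties
open import Data.Nat.Divisibility using (_∣_; divides; _∣?_; ∣⇒≤; 1∣_; ∣1⇒≡1)
open import Data.Nat.DivMod using (_/_; m*n/n≡m)
open import Data.Nat.Solver using (module +-*-Solver)
open import Data.Integer as ℤ using (+_)
import Data.Integer.Properties as ℤ
open import Data.List using (List; []; _∷_; map; filter; upTo; length)
open import Data.List.Properties using (length-map)
import Data.List.Relation.Unary.All as All
import Data.List.Relation.Unary.All.Properties as All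
open import Data.List.Relation.Unary.Any using (here; there)
open import Data.List.Relation.Unary.Unique.Propositional using (Unique; []; _∷_)
import Data.List.Relation.Unary.Unique.Propositional.Properties as Unique
open import Data.List.Membership.Propositional using (_∈_)
open import Data.List.Membership.Propositional.Properties using (∈-filter⁺; ∈-filter⁻; ∈-upTo⁺; ∈-map⁺; ∈-map⁻)
open import Data.Product using (Σ; ∃; ∃₂; _×_; _,_; proj₁; proj₂)
open import Data.Sum using (_⊎_; inj₁; inj₂; [_,_]′)
open import Data.Empty using (⊥-elim)
open import Function using (_∘_)
open import Function.Bundles using (_⇔_; mk⇔; Equivalence)
open import Relation.Nullary using (¬_; yes; no)
open import Relation.Nullary.Decidable using (_×-dec_; ¬?)
open import Relation.Unary using (Decidable)
open import Relation.Binary.PropositionalEquality hiding ([_])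
open +-*-Solver
open Equivalence using (to; from)

map⁺-injectiveOn : ∀ {A B : Set} (g : A → B) {xs : List A} →
  (∀ {x x'} → x ∈ xs → x' ∈ xs → g x ≡ g x' → x ≡ x') → Unique xs → Unique (map g xs)
map⁺-injectiveOn g {[]} inj [] = []
map⁺-injectiveOn g {x ∷ xs} inj (x∉xs ∷ u) =
  All.map⁺ (All.tabulate λ x'∈xs gx≡gx' → All.lookup x∉xs x'∈xs (inj (here refl) (there x'∈xs) gx≡gx'))
  ∷ map⁺-injectiveOn g (λ p q → inj (there p) (there q)) u

HasCard-bounded : ∀ {P : ℕ → Set} → Decidable P → ∀ N → (∀ {x} → P x → x < N) → ∃ (HasCard P)
HasCard-bounded {P} P? N bound = length L , L , Unique.filter⁺ P? (Unique.upTo⁺ N) ,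
  (λ x → mk⇔ (proj₂ ∘ ∈-filter⁻ P? {xs = upTo N}) (λ Px → ∈-filter⁺ P? (∈-upTo⁺ (bound Px)) Px)) , refl
  where
  L : List ℕ
  L = filter P? (upTo N)

HasCard-image : ∀ {P Q : ℕ → Set} {k} (g : ℕ → ℕ) → HasCard Q k →
  (∀ {x x'} → Q x → Q x' → g x ≡ g x' → x ≡ x') →
  (∀ y → P y ⇔ ∃ λ x → Q x × g x ≡ y) → HasCard P k
HasCard-image g (L , unique , L⇔Q , refl) inj P⇔image =
  map g L ,
  map⁺-injectiveOn g (λ x∈L x'∈L → inj (to (L⇔Q _) x∈L) (to (L⇔Q _) x'∈L)) unique ,
  (λ y → mk⇔ (λ y∈ → let x , x∈L , y≡gx = ∈-map⁻ g y∈ in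
                      from (P⇔image y) (x , to (L⇔Q x) x∈L , sym y≡gx))
             (λ Py → let x , Qx , gx≡y = to (P⇔image y) Py in
                      subst (_∈ map g L) gx≡y (∈-map⁺ g (from (L⇔Q x) Qx)))) ,
  length-map g L

HasCard-∷ : ∀ {P Q : ℕ → Set} {k} a → HasCard P k → ¬ P a →
  (∀ x → Q x ⇔ (x ≡ a ⊎ P x)) → HasCard Q (suc k)
HasCard-∷ {P} a (L , unique , L⇔P , len) ¬Pa Q⇔ =
  a ∷ L ,
  All.tabulate (λ {x} x∈L a≡x → ¬Pa (subst P (sym a≡x) (to (L⇔P x) x∈L))) ∷ unique ,
  (λ x → mk⇔ (λ { (here x≡a) → from (Q⇔ x) (inj₁ x≡a) ; (there x∈L) → from (Q⇔ x) (inj₂ (to (L⇔P x) x∈L)) })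
             (λ Qx → [ here , there ∘ from (L⇔P x) ]′ (to (Q⇔ x) Qx))) ,
  cong suc len

even⊎odd : ∀ n → (∃ λ e → n ≡ 2 * e) ⊎ (∃ λ e → n ≡ suc (2 * e))
even⊎odd zero = inj₁ (0 , refl)
even⊎odd (suc n) with even⊎odd n
... | inj₁ (e , refl) = inj₂ (e , refl)
... | inj₂ (e , refl) = inj₁ (suc e , cong suc (sym (+-suc e (e + 0))))

2∤1+2n : ∀ n → ¬ 2 ∣ suc (2 * n)
2∤1+2n n (divides k eq) = even≢odd k n (sym (trans eq (*-comm k 2)))

2∤⇒odd : ∀ {n} → ¬ 2 ∣ n → ∃ λ e → n ≡ suc (2 * e)
2∤⇒odd {n} 2∤n with even⊎odd n
... | inj₁ (e , refl) = ⊥-elim (2∤n (divides e (*-comm 2 e)))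
... | inj₂ odd = odd

⌊1+2n/2⌋≡n : ∀ n → ⌊ suc (2 * n) /2⌋ ≡ n
⌊1+2n/2⌋≡n zero = refl
⌊1+2n/2⌋≡n (suc n) = cong suc (trans (cong ⌊_/2⌋ (+-suc n (n + 0))) (⌊1+2n/2⌋≡n n))

+m-+n≡+[m∸n] : ∀ {a n} → n ≤ a → + a ℤ.- + n ≡ + (a ∸ n)
+m-+n≡+[m∸n] {a} {n} n≤a = trans (ℤ.m-n≡m⊖n a n) (ℤ.⊖-≥ n≤a)

+m-+n≡-+[n∸m] : ∀ {a n} → a < n → + a ℤ.- + n ≡ ℤ.- + (n ∸ a)
+m-+n≡-+[n∸m] {a} {n} a<n = trans (ℤ.m-n≡m⊖n a n) (ℤ.⊖-< a<n)

+≡-+⇒≡0 : ∀ {x y} → + x ≡ ℤ.- + y → y ≡ 0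
+≡-+⇒≡0 {y = zero} _ = refl

-- 2(y+1) - n cannot be negative because 2b ≥ 0.
commaEq⇔factorisation : ∀ {b y n} →
  CommaEq b y n ⇔ ∃ λ m → n + m ≡ 2 * (y + 1) × 2 * b ≡ (n + 1) * m
commaEq⇔factorisation {b} {y} {n} = mk⇔ factorise unfactorise
  where
  a : ℕ
  a = 2 * (y + 1)

  factorise : CommaEq b y n → ∃ λ m → n + m ≡ a × 2 * b ≡ (n + 1) * m
  factorise eq with n ≤? a
  ... | yes n≤a = a ∸ n , m+[n∸m]≡n n≤a ,
    ℤ.+-injective (trans eq (trans (cong (+ (n + 1) ℤ.*_) (+m-+n≡+[m∸n] n≤a)) (sym (ℤ.pos-* (n + 1) (a ∸ n)))))
  ... | no n≰a = ⊥-elim ([ (λ n+1≡0 → 1+n≢0 (trans (+-comm 1 n) n+1≡0)) , m>n⇒m∸n≢0 (≰⇒> n≰a) ]′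
    (m*n≡0⇒m≡0∨n≡0 (n + 1) (+≡-+⇒≡0 (begin
      + (2 * b)                         ≡⟨ eq ⟩
      + (n + 1) ℤ.* (+ a ℤ.- + n)        ≡⟨ cong (+ (n + 1) ℤ.*_) (+m-+n≡-+[n∸m] (≰⇒> n≰a)) ⟩
      + (n + 1) ℤ.* ℤ.- + (n ∸ a)        ≡⟨ ℤ.neg-distribʳ-* (+ (n + 1)) (+ (n ∸ a)) ⟨
      ℤ.- (+ (n + 1) ℤ.* + (n ∸ a))      ≡⟨ cong ℤ.-_ (ℤ.pos-* (n + 1) (n ∸ a)) ⟨
      ℤ.- + ((n + 1) * (n ∸ a))          ∎))))
    where open ≡-Reasoning

  unfactorise : (∃ λ m → n + m ≡ a × 2 * b ≡ (n + 1) * m) → CommaEq b y n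
  unfactorise (m , n+m≡a , 2b≡) = begin
    + (2 * b)                     ≡⟨ cong +_ 2b≡ ⟩
    + ((n + 1) * m)               ≡⟨ ℤ.pos-* (n + 1) m ⟩
    + (n + 1) ℤ.* + m             ≡⟨ cong (+ (n + 1) ℤ.*_) (trans (+m-+n≡+[m∸n] (m≤m+n n m)) (cong +_ (m+n∸m≡n n m))) ⟨
    + (n + 1) ℤ.* (+ (n + m) ℤ.- + n) ≡⟨ cong (λ c → + (n + 1) ℤ.* (+ c ℤ.- + n)) n+m≡a ⟩
    + (n + 1) ℤ.* (+ a ℤ.- + n)       ∎
    where open ≡-Reasoning

even+odd≢even : ∀ a b c → 2 * a + suc (2 * b) ≢ 2 * c
even+odd≢even a b c eq = even≢odd c (a + b) (trans (sym eq)
  (solve 2 (λ a b → con 2 :* a :+ (con 1 :+ con 2 :* b) := con 1 :+ con 2 :* (a :+ b)) refl a b))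

2*m≡2*n⇒m≡n : ∀ {x y} → 2 * x ≡ 2 * y → x ≡ y
2*m≡2*n⇒m≡n {x} {y} = *-cancelˡ-≡ x y 2

record Split (b y e q : ℕ) : Set where
  constructor mkSplit
  field
    product : b ≡ q * suc (2 * e)
    sum     : e + q ≡ suc y

factorisation⇒split : ∀ {b y n m} → n + m ≡ 2 * (y + 1) → 2 * b ≡ (n + 1) * m → ∃₂ (Split b y)
factorisation⇒split {b} {y} {n} {m} sum prod with even⊎odd n | even⊎odd m
... | inj₁ (e , refl) | inj₂ (q , refl) = ⊥-elim (even+odd≢even e q (y + 1) sum)
... | inj₂ (q , refl) | inj₁ (e , refl) = ⊥-elim (even+odd≢even e q (y + 1) (trans (+-comm (2 * e) _) sum))
... | inj₁ (e , refl) | inj₁ (q , refl) = e , q , mkSplit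
  (2*m≡2*n⇒m≡n (trans prod (solve 2 (λ e q → (con 2 :* e :+ con 1) :* (con 2 :* q) := con 2 :* (q :* (con 1 :+ con 2 :* e))) refl e q)))
  (2*m≡2*n⇒m≡n (trans (solve 2 (λ e q → con 2 :* (e :+ q) := con 2 :* e :+ con 2 :* q) refl e q)
        (trans sum (cong (2 *_) (+-comm y 1)))))
... | inj₂ (q , refl) | inj₂ (e , refl) = e , suc q , mkSplit
  (2*m≡2*n⇒m≡n (trans prod (solve 2 (λ e q → (con 1 :+ con 2 :* q :+ con 1) :* (con 1 :+ con 2 :* e)
                                    := con 2 :* ((con 1 :+ q) :* (con 1 :+ con 2 :* e))) refl e q)))
  (2*m≡2*n⇒m≡n (trans (solve 2 (λ e q → con 2 :* (e :+ (con 1 :+ q)) := (con 1 :+ con 2 :* q) :+ (con 1 :+ con 2 :* e)) refl e q)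
        (trans sum (cong (2 *_) (+-comm y 1)))))

split-nontrivial : ∀ {b y e q} → Split b y e q → y < b ∸ 1 → 0 < e
split-nontrivial {e = suc _} _ _ = z<s
split-nontrivial {y = y} {e = zero} (mkSplit refl refl) y<b-1 = ⊥-elim (<-irrefl (sym (*-identityʳ y)) y<b-1)

split⇒goodY : ∀ {b y e q} → Split b y e q → 0 < e → 0 < b → GoodY b y
split⇒goodY {q = zero} (mkSplit refl _) _ ()
split⇒goodY {e = suc e} {suc q} (mkSplit refl refl) _ _ =
  <-≤-trans z<s (m≤n+m (suc q) e) ,
  subst (suc (e + suc q) ≤_)
    (solve 2 (λ e q → (con 1 :+ (e :+ (con 1 :+ q))) :+ (e :+ con 2 :* q :* (con 1 :+ e))
                    := con 2 :* (con 1 :+ e) :+ q :* (con 1 :+ con 2 :* (con 1 :+ e))) refl e q)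
    (m≤m+n _ _) ,
  2 * suc e , z<s ,
  from (commaEq⇔factorisation {suc q * suc (2 * suc e)} {e + suc q} {2 * suc e}) (2 * suc q ,
    solve 2 (λ e q → con 2 :* (con 1 :+ e) :+ con 2 :* (con 1 :+ q) := con 2 :* ((e :+ (con 1 :+ q)) :+ con 1)) refl e q ,
    solve 2 (λ e q → con 2 :* ((con 1 :+ q) :* (con 1 :+ con 2 :* (con 1 :+ e)))
                   := (con 2 :* (con 1 :+ e) :+ con 1) :* (con 2 :* (con 1 :+ q))) refl e q)

[r+q]*[1+2e]≡q*[1+2[e+r]]⇒r≡0 : ∀ e q r → (r + q) * suc (2 * e) ≡ q * suc (2 * (e + r)) → r ≡ 0
[r+q]*[1+2e]≡q*[1+2[e+r]]⇒r≡0 e q zero _ = refl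
[r+q]*[1+2e]≡q*[1+2[e+r]]⇒r≡0 e q (suc r) eq = ⊥-elim (even≢odd q e (sym
  (*-cancelˡ-≡ _ _ (suc r) (+-cancelˡ-≡ (q * suc (2 * e)) _ _ (begin
    q * suc (2 * e) + suc r * suc (2 * e) ≡⟨ solve 3 (λ e q r → q :* (con 1 :+ con 2 :* e) :+ (con 1 :+ r) :* (con 1 :+ con 2 :* e)
                                                         := ((con 1 :+ r) :+ q) :* (con 1 :+ con 2 :* e)) refl e q r ⟩
    (suc r + q) * suc (2 * e)             ≡⟨ eq ⟩
    q * suc (2 * (e + suc r))             ≡⟨ solve 3 (λ e q r → q :* (con 1 :+ con 2 :* (e :+ (con 1 :+ r)))
                                                         := q :* (con 1 :+ con 2 :* e) :+ (con 1 :+ r) :* (con 2 :* q)) refl e q r ⟩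
    q * suc (2 * e) + suc r * (2 * q)     ∎)))))
  where open ≡-Reasoning

odd-cofactor-unique-≤ : ∀ {e q e' q'} → e ≤ e' → e + q ≡ e' + q' → q * suc (2 * e) ≡ q' * suc (2 * e') → e ≡ e'
odd-cofactor-unique-≤ {e} {q} {q' = q'} e≤e' sum prod with m≤n⇒∃[o]m+o≡n e≤e'
... | r , refl with +-cancelˡ-≡ e q (r + q') (trans sum (+-assoc e r q'))
...   | refl = sym (trans (cong (λ x → e + x) ([r+q]*[1+2e]≡q*[1+2[e+r]]⇒r≡0 e q' r prod)) (+-identityʳ e))

odd-cofactor-unique : ∀ e q e' q' → e + q ≡ e' + q' → q * suc (2 * e) ≡ q' * suc (2 * e') → e ≡ e'
odd-cofactor-unique e q e' q' sum prod with ≤-total e e'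
... | inj₁ e≤e' = odd-cofactor-unique-≤ e≤e' sum prod
... | inj₂ e'≤e = sym (odd-cofactor-unique-≤ e'≤e (sym sum) (sym prod))

ProperOddDivisor : ℕ → ℕ → Set
ProperOddDivisor b d = OddDivisor b d × d ≢ 1

properOddDivisor? : ∀ b → Decidable (ProperOddDivisor b)
properOddDivisor? b d = ((d ∣? b) ×-dec ¬? (2 ∣? d)) ×-dec ¬? (d ≟ 1)

oddDivisor⇔1⊎proper : ∀ {b d} → OddDivisor b d ⇔ (d ≡ 1 ⊎ ProperOddDivisor b d)
oddDivisor⇔1⊎proper {b} {d} = mk⇔ classify [ (λ { refl → 1∣ b , (λ ()) ∘ ∣1⇒≡1 }) , proj₁ ]′
  where
  classify : OddDivisor b d → d ≡ 1 ⊎ ProperOddDivisor b d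
  classify odd with d ≟ 1
  ... | yes d≡1 = inj₁ d≡1
  ... | no d≢1 = inj₂ (odd , d≢1)

divisorToY : ℕ → ℕ → ℕ
divisorToY b zero = zero
divisorToY b d@(suc _) = ⌊ d /2⌋ + b / d ∸ 1

divisorToY-odd : ∀ {b} e q → b ≡ q * suc (2 * e) → divisorToY b (suc (2 * e)) ≡ e + q ∸ 1
divisorToY-odd e q refl = cong₂ (λ x z → x + z ∸ 1) (⌊1+2n/2⌋≡n e) (m*n/n≡m q (suc (2 * e)))

split⇒properOddDivisor : ∀ {b y e q} → Split b y e q → 0 < e →
  ProperOddDivisor b (suc (2 * e)) × divisorToY b (suc (2 * e)) ≡ y
split⇒properOddDivisor {e = e@(suc _)} {q} (mkSplit b≡ e+q≡) _ =
  ((divides q b≡ , 2∤1+2n e) , λ ()) , trans (divisorToY-odd e q b≡) (cong (_∸ 1) e+q≡)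

properOddDivisor⇒split : ∀ {b d} → ProperOddDivisor b d →
  ∃₂ λ e q → d ≡ suc (2 * e) × 0 < e × Split b (divisorToY b d) e q
properOddDivisor⇒split ((divides q b≡qd , 2∤d) , d≢1) with 2∤⇒odd 2∤d
... | zero , refl = ⊥-elim (d≢1 refl)
... | e@(suc _) , refl = e , q , refl , z<s , mkSplit b≡qd (sym (cong suc (divisorToY-odd e q b≡qd)))

divisorToY-injective : ∀ {b d d'} → ProperOddDivisor b d → ProperOddDivisor b d' →
  divisorToY b d ≡ divisorToY b d' → d ≡ d'
divisorToY-injective Pd Pd' eq with properOddDivisor⇒split Pd | properOddDivisor⇒split Pd'
... | e , q , refl , _ , mkSplit b≡ s | e' , q' , refl , _ , mkSplit b≡' s' =
  cong (suc ∘ (2 *_)) (odd-cofactor-unique e q e' q' (trans s (trans (cong suc eq) (sym s'))) (trans (sym b≡) b≡'))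

goodY⇔divisorImage : ∀ {b y} → 0 < b → GoodY b y ⇔ ∃ λ d → ProperOddDivisor b d × divisorToY b d ≡ y
goodY⇔divisorImage {b} {y} 0<b = mk⇔ toImage fromImage
  where
  toImage : GoodY b y → ∃ λ d → ProperOddDivisor b d × divisorToY b d ≡ y
  toImage (_ , y<b-1 , n , _ , commaEq) =
    let m , sum , prod = to (commaEq⇔factorisation {b} {y} {n}) commaEq
        e , _ , s = factorisation⇒split {n = n} {m} sum prod
    in suc (2 * e) , split⇒properOddDivisor s (split-nontrivial s y<b-1)

  fromImage : (∃ λ d → ProperOddDivisor b d × divisorToY b d ≡ y) → GoodY b y
  fromImage (_ , Pd , refl) = let _ , _ , _ , 0<e , s = properOddDivisor⇒split Pd in split⇒goodY s 0<e 0<b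

lemma5 : (b : ℕ) → 3 ≤ b →
    Σ ℕ λ k → HasCard (GoodY b) k × HasCard (OddDivisor b) (suc k)
lemma5 b@(suc _) _
  with HasCard-bounded (properOddDivisor? b) (suc b) (λ ((d∣b , _) , _) → s≤s (∣⇒≤ d∣b))
... | k , proper =
  k ,
  HasCard-image (divisorToY b) proper divisorToY-injective (λ _ → goodY⇔divisorImage z<s) ,
  HasCard-∷ 1 proper (λ (_ , 1≢1) → 1≢1 refl) (λ _ → oddDivisor⇔1⊎proper)
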